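{- Let $G$ and $H$ be connected graphs with $\chi(H)\geq 3$. Then: (i) $R_2(H)\geq R(H,\mathcal{M}(H))+(\chi(H)-2)(|V(H)|-1)$; (ii) $R(G\cup H,\mathcal{M}(H))\leq \max\{R(G,H),\,R(H,\mathcal{M}(H))+|V(G)|\}$.
   Context: For a graph $H$ with $\chi(H)=p\geq 3$, the decomposition family $\mathcal{M}(H)$ is the set of minimal graphs $M$ (with respect to subgraph containment) for which there exists an integer $t$ with $H\subseteq (M\cup\overline{K}_{t-|V(M)|})\vee K_{(p-2)\times t}$, where $\vee$ is the join, $\overline{K}_m$ is the edgeless graph on $m$ vertices and $K_{(p-2)\times t}$ is the complete $(p-2)$-partite graph with parts of size $t$. $\cup$ is vertex-disjoint union. $R_2(H)$ is the minimum $n$ such that every $2$-edge-coloring of $K_n$ contains a monochromatic $H$. For a graph $A$ and a graph or family of graphs $\mathcal{B}$, $R(A,\mathcal{B})$ is the minimum $n$ such that every coloring of $E(K_n)$ with colors $1,2$ contains a color-$1$ copy of $A$ or a color-$2$ copy of (some member of) $\mathcal{B}$. -}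

module Defs where

open import Data.Nat using (ℕ; zero; suc; _+_; _∸_; _≤_; _<_)
open import Data.Bool using (Bool; true; false)
open import Data.Fin using (Fin; splitAt)
open import Data.Sum using (_⊎_; inj₁; inj₂)
open import Data.Product using (Σ; _×_; _,_; ∃)
open import Data.Empty using (⊥)
open import Data.Unit using (⊤)
open import Relation.Nullary using (¬_)
open import Relation.Binary.PropositionalEquality using (_≡_; _≢_; refl)

record Graph : Set where
  field
    n     : ℕ
    adj   : Fin n → Fin n → Bool
    sym   : ∀ u v → adj u v ≡ adj v u
    irrefl : ∀ u → adj u u ≡ false
open Graph public

∣V∣ : Graph → ℕ
∣V∣ G = n G

Embeds : (H : Graph) (V : Set) (E : V → V → Set) → Set
Embeds H V E =
  Σ (Fin (n H) → V) λ f →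
    (∀ u v → f u ≡ f v → u ≡ v) ×
    (∀ u v → adj H u v ≡ true → E (f u) (f v))

_⊆G_ : Graph → Graph → Set
H ⊆G G = Embeds H (Fin (n G)) (λ x y → adj G x y ≡ true)

data Reachable (G : Graph) : Fin (n G) → Fin (n G) → Set where
  here : ∀ {u} → Reachable G u u
  step : ∀ {u v w} → adj G u v ≡ true → Reachable G v w → Reachable G u w

Connected : Graph → Set
Connected G = (1 ≤ n G) × (∀ u v → Reachable G u v)

Colorable : Graph → ℕ → Set
Colorable G k =
  Σ (Fin (n G) → Fin k) λ c → ∀ u v → adj G u v ≡ true → c u ≢ c v

HasChromaticNumber : Graph → ℕ → Set
HasChromaticNumber G p = Colorable G p × (∀ k → Colorable G k → p ≤ k)

-- Vertex-disjoint union G ∪ H (vertices of G first, then those of H)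

∪adj : (G H : Graph) → Fin (n G + n H) → Fin (n G + n H) → Bool
∪adj G H x y with splitAt (n G) x | splitAt (n G) y
... | inj₁ a | inj₁ b = adj G a b
... | inj₂ a | inj₂ b = adj H a b
... | inj₁ _ | inj₂ _ = false
... | inj₂ _ | inj₁ _ = false

∪sym : (G H : Graph) → ∀ x y → ∪adj G H x y ≡ ∪adj G H y x
∪sym G H x y with splitAt (n G) x | splitAt (n G) y
... | inj₁ a | inj₁ b = Graph.sym G a b
... | inj₂ a | inj₂ b = Graph.sym H a b
... | inj₁ _ | inj₂ _ = refl
... | inj₂ _ | inj₁ _ = refl

∪irrefl : (G H : Graph) → ∀ x → ∪adj G H x x ≡ false
∪irrefl G H x with splitAt (n G) x
... | inj₁ a = Graph.irrefl G a
... | inj₂ a = Graph.irrefl H a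

_∪G_ : Graph → Graph → Graph
G ∪G H = record
  { n = n G + n H ; adj = ∪adj G H ; sym = ∪sym G H ; irrefl = ∪irrefl G H }

-- The host graph (M ∪ K̄_{t-|V(M)|}) ∨ K_{(p-2)×t}, as a vertex type with
-- an adjacency relation.

HostV : Graph → ℕ → ℕ → Set
HostV M p t = (Fin (n M) ⊎ Fin (t ∸ n M)) ⊎ (Fin (p ∸ 2) × Fin t)

HostE : (M : Graph) (p t : ℕ) → HostV M p t → HostV M p t → Set
HostE M p t (inj₁ (inj₁ a)) (inj₁ (inj₁ b)) = adj M a b ≡ true
HostE M p t (inj₁ _)        (inj₁ _)        = ⊥
HostE M p t (inj₁ _)        (inj₂ _)        = ⊤
HostE M p t (inj₂ _)        (inj₁ _)        = ⊤
HostE M p t (inj₂ (i , _))  (inj₂ (j , _))  = i ≢ j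

DecompProp : (H : Graph) (p : ℕ) → Graph → Set
DecompProp H p M = ∃ λ t → Embeds H (HostV M p t) (HostE M p t)

-- Membership in the decomposition family 𝓜(H), where p = χ(H):
-- M has the property and is minimal w.r.t. subgraph containment.
𝓜 : (H : Graph) (p : ℕ) → Graph → Set
𝓜 H p M =
  DecompProp H p M × (∀ M' → M' ⊆G M → DecompProp H p M' → M ⊆G M')

-- 2-edge-colourings of K_N: colour 1 = true, colour 2 = false
Coloring : ℕ → Set
Coloring N = Σ (Fin N → Fin N → Bool) λ c → ∀ x y → c x y ≡ c y x

MonoCopy : (N : ℕ) → Coloring N → Bool → Graph → Set
MonoCopy N (c , _) col A = Embeds A (Fin N) (λ x y → c x y ≡ col)

Arrows : ℕ → Graph → (Graph → Set) → Set
Arrows N A 𝓑 =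
  (c : Coloring N) → MonoCopy N c true A ⊎ (∃ λ B → 𝓑 B × MonoCopy N c false B)

Single : Graph → Graph → Set
Single B M = M ≡ B

IsRamsey : Graph → (Graph → Set) → ℕ → Set
IsRamsey A 𝓑 r = Arrows r A 𝓑 × (∀ m → m < r → ¬ Arrows m A 𝓑)

{-# OPTIONS --safe #-}
module Submission where

open import Defs hiding (sym)
open import Data.Nat as ℕ using (ℕ; zero; suc; _+_; _∸_; _*_; _≤_; _<_; _⊔_; pred)
import Data.Nat.Properties as ℕ
open import Data.Nat.Induction using (<-wellFounded)
open import Data.Bool using (Bool; true; false; not; _∧_; _∨_)
import Data.Bool.Properties as Bool
open import Data.Fin as Fin using (Fin; zero; suc; splitAt; punchIn; punchOut; finToFun; funToFin)
import Data.Fin.Properties as Fin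
open import Data.Fin.Subset using (Subset; _∈_; _⊂_)
open import Data.Fin.Subset.Induction using (⊂-wellFounded)
open import Data.Vec using (tabulate)
import Data.Vec.Properties as Vec
open import Data.Maybe using (Maybe; just; nothing)
open import Data.Sum using (_⊎_; inj₁; inj₂; [_,_]′)
import Data.Sum.Properties as Sum
open import Data.Sum.Function.Propositional using (_⊎-↔_)
open import Data.Product using (_×_; _,_; ∃; ∃₂; proj₁; proj₂; uncurry)
open import Data.Product.Properties using (,-injectiveʳ)
open import Data.Empty using (⊥; ⊥-elim)
open import Data.Unit using (tt)
open import Function using (_∘_; id; _⇔_; _↔_; Inverse; mk⇔)
open import Function.Properties.Inverse using (↔-refl; ↔-sym; ↔-trans)
open import Induction.WellFounded using (Acc; acc)
open import Relation.Nullary using (¬_; Dec; yes; no; does)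
open import Relation.Nullary.Decidable as Dec
  using (_×-dec_; _→-dec_; map′; ¬?; dec-true; dec-false; does-⇔; decidable-stable)
open import Relation.Binary.PropositionalEquality hiding ([_])

-- (i) Colour K_N, N = R₂(H) − (p−2)(|H|−1), arbitrarily and add p−2 disjoint red cliques of
-- size |H|−1, joined to each other and to K_N in blue; the result contains a monochromatic H.
-- A red H is connected, so it lies in K_N or inside one clique, which is too small.  A blue H
-- embeds in (blue graph of K_N) ∨ K_{(p−2)×(|H|−1)}, so the blue graph of K_N has the
-- decomposition property and therefore contains a ⊆-minimal subgraph with it, a blue member
-- of 𝓜(H).  Hence R(H, 𝓜(H)) ≤ N.
-- (ii) A blue H yields a blue member of 𝓜(H) in the same way; a red G leaves R(H, 𝓜(H))
-- vertices outside it, which span a blue member of 𝓜(H) or a red H disjoint from G.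
-- The minimal subgraph is found by deleting vertices and edges while the property persists;
-- this is constructive because the property is decidable: hosts with t = |M| + |H| suffice.

private variable
  V W : Set
  E : V → V → Set

IsEmbedding : (H : Graph) (E : V → V → Set) → (Fin (n H) → V) → Set
IsEmbedding H E f =
  (∀ u v → f u ≡ f v → u ≡ v) × (∀ u v → adj H u v ≡ true → E (f u) (f v))

Embeds-map : ∀ {H} {E′ : W → W → Set} (φ : V → W) → (∀ x y → φ x ≡ φ y → x ≡ y) →
  (∀ x y → E x y → E′ (φ x) (φ y)) → Embeds H V E → Embeds H W E′
Embeds-map φ φ-inj φ-hom (f , f-inj , f-hom) =
  φ ∘ f , (λ u v eq → f-inj u v (φ-inj _ _ eq)) , (λ u v uv → φ-hom _ _ (f-hom u v uv))

IsEmbedding-cong : ∀ {H} {f g : Fin (n H) → V} → (∀ u → f u ≡ g u) →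
  IsEmbedding H E f → IsEmbedding H E g
IsEmbedding-cong {E = E} f≗g (f-inj , f-hom) =
  (λ u v eq → f-inj u v (trans (f≗g u) (trans eq (sym (f≗g v))))) ,
  (λ u v uv → subst₂ E (f≗g u) (f≗g v) (f-hom u v uv))

↔-to-injective : (ι : V ↔ W) → ∀ x y → Inverse.to ι x ≡ Inverse.to ι y → x ≡ y
↔-to-injective ι x y eq =
  trans (sym (strictlyInverseʳ x)) (trans (cong from eq) (strictlyInverseʳ y))
  where open Inverse ι

Embeds-↔ : ∀ {H} (ι : V ↔ W) → let open Inverse ι in
  Embeds H W (λ x y → E (from x) (from y)) ⇔ Embeds H V E
Embeds-↔ {E = E} {H} ι = mk⇔
  (Embeds-map {H = H} {E′ = E} from (↔-to-injective (↔-sym ι)) (λ _ _ e → e))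
  (Embeds-map {H = H} {E′ = λ x y → E (from x) (from y)} to (↔-to-injective ι)
    (λ x y → subst₂ E (sym (strictlyInverseʳ x)) (sym (strictlyInverseʳ y))))
  where open Inverse ι

isEmbedding? : ∀ H {m} {E : Fin m → Fin m → Set} → (∀ x y → Dec (E x y)) →
  (f : Fin (n H) → Fin m) → Dec (IsEmbedding H E f)
isEmbedding? H E? f =
  (Fin.all? λ u → Fin.all? λ v → (f u Fin.≟ f v) →-dec (u Fin.≟ v)) ×-dec
  (Fin.all? λ u → Fin.all? λ v → (adj H u v Bool.≟ true) →-dec E? (f u) (f v))

embedsFin? : ∀ H {m} {E : Fin m → Fin m → Set} → (∀ x y → Dec (E x y)) →
  Dec (Embeds H (Fin m) E)
embedsFin? H {E = E} E? = map′
  (λ (k , emb) → finToFun k , emb)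
  (λ (f , emb) → funToFin f , IsEmbedding-cong {E = E} {H} (sym ∘ Fin.finToFun-funToFin f) emb)
  (Fin.any? (isEmbedding? H E? ∘ finToFun))

embeds? : ∀ H {m} → (V ↔ Fin m) → (∀ x y → Dec (E x y)) → Dec (Embeds H V E)
embeds? {E = E} H ι E? =
  Dec.map (Embeds-↔ {E = E} {H} ι) (embedsFin? H (λ x y → E? (from x) (from y)))
  where open Inverse ι

adj⇒≢ : ∀ M {u v} → adj M u v ≡ true → u ≢ v
adj⇒≢ M {u} uv refl = Bool.not-¬ (irrefl M u) uv

Embeds-distinct : ∀ {H} → Embeds H V E → Embeds H V (λ x y → x ≢ y × E x y)
Embeds-distinct {H = H} (f , f-inj , f-hom) =
  f , f-inj , λ u v uv → adj⇒≢ H uv ∘ f-inj u v , f-hom u v uv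

Embeds-factor : ∀ {H} {A : Set} (φ : A → V) ((f , _) : Embeds H V E) →
  (∀ u → ∃ λ a → φ a ≡ f u) → Embeds H A (λ a b → E (φ a) (φ b))
Embeds-factor {E = E} {H} {A} φ (f , f-inj , f-hom) onto =
  g , (λ u v eq → f-inj u v (trans (sym (φg u)) (trans (cong φ eq) (φg v)))) ,
  (λ u v uv → subst₂ E (sym (φg u)) (sym (φg v)) (f-hom u v uv))
  where
  g : Fin (n H) → A
  g u = proj₁ (onto u)
  φg : ∀ u → φ (g u) ≡ f u
  φg u = proj₂ (onto u)

Embeds-∪ : ∀ {G H} ((f , _) : Embeds G V E) ((h , _) : Embeds H V E) → (∀ u v → f u ≢ h v) →
  Embeds (G ∪G H) V E
Embeds-∪ {E = E} {G} {H} (f , f-inj , f-hom) (h , h-inj , h-hom) f∉h =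
  [ f , h ]′ ∘ splitAt (n G) ,
  (λ x y → ↔-to-injective (Fin.+↔⊎ {n G} {n H}) x y
    ∘ [f,h]-inj (splitAt (n G) x) (splitAt (n G) y)) ,
  hom
  where
  [f,h]-inj : ∀ s t → [ f , h ]′ s ≡ [ f , h ]′ t → s ≡ t
  [f,h]-inj (inj₁ u) (inj₁ v) eq = cong inj₁ (f-inj u v eq)
  [f,h]-inj (inj₁ u) (inj₂ v) eq = ⊥-elim (f∉h u v eq)
  [f,h]-inj (inj₂ u) (inj₁ v) eq = ⊥-elim (f∉h v u (sym eq))
  [f,h]-inj (inj₂ u) (inj₂ v) eq = cong inj₂ (h-inj u v eq)
  hom : ∀ x y → adj (G ∪G H) x y ≡ true →
    E ([ f , h ]′ (splitAt (n G) x)) ([ f , h ]′ (splitAt (n G) y))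
  hom x y xy with splitAt (n G) x | splitAt (n G) y
  ... | inj₁ u | inj₁ v = f-hom u v xy
  ... | inj₂ u | inj₂ v = h-hom u v xy

Connected-constant : ∀ {H} {C : Set} → Connected H → (κ : Fin (n H) → C) →
  (∀ u v → adj H u v ≡ true → κ u ≡ κ v) → ∀ u v → κ u ≡ κ v
Connected-constant {H} (_ , reach) κ κ-edge u v = along (reach u v)
  where
  along : ∀ {u v} → Reachable H u v → κ u ≡ κ v
  along here = refl
  along (step uv r) = trans (κ-edge _ _ uv) (along r)

⊆G-refl : ∀ {M} → M ⊆G M
⊆G-refl = id , (λ _ _ eq → eq) , (λ _ _ e → e)

⊆G-trans : ∀ {A B C} → A ⊆G B → B ⊆G C → A ⊆G C
⊆G-trans {A} {B} {C} A⊆B (g , g-inj , g-hom) =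
  Embeds-map {H = A} {E′ = λ x y → adj C x y ≡ true} g g-inj g-hom A⊆B

induced : (M : Graph) {k : ℕ} → (Fin k → Fin (n M)) → Graph
induced M {k} ι = record
  { n = k ; adj = λ a b → adj M (ι a) (ι b)
  ; sym = λ a b → Graph.sym M (ι a) (ι b) ; irrefl = λ a → irrefl M (ι a) }

punchIn′ : ∀ {m} → Fin m → Fin (pred m) → Fin m
punchIn′ {suc m} = punchIn

punchOut′ : ∀ {m} {w x : Fin m} → w ≢ x → Fin (pred m)
punchOut′ {suc m} = punchOut

punchIn′-injective : ∀ {m} (w : Fin m) i j → punchIn′ w i ≡ punchIn′ w j → i ≡ j
punchIn′-injective {suc m} = Fin.punchIn-injective

punchIn′-punchOut′ : ∀ {m} {w x : Fin m} (w≢x : w ≢ x) → punchIn′ w (punchOut′ w≢x) ≡ x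
punchIn′-punchOut′ {suc m} = Fin.punchIn-punchOut

pred< : ∀ {m} → Fin m → pred m < m
pred< {suc m} _ = ℕ.n<1+n m

removeVertex : (M : Graph) → Fin (n M) → Graph
removeVertex M w = induced M (punchIn′ w)

removeVertex-⊆ : ∀ M w → removeVertex M w ⊆G M
removeVertex-⊆ M w = punchIn′ w , punchIn′-injective w , λ _ _ e → e

⊆-removeVertex : ∀ {M′ M} ((f , _) : M′ ⊆G M) {w} → (∀ u → f u ≢ w) → M′ ⊆G removeVertex M w
⊆-removeVertex {M′} {M} (f , f-inj , f-hom) {w} w∉f =
  h , (λ u v eq → f-inj u v (trans (sym (f≡ u)) (trans (cong (punchIn′ w) eq) (f≡ v)))) ,
  (λ u v uv → subst₂ (λ a b → adj M a b ≡ true) (sym (f≡ u)) (sym (f≡ v)) (f-hom u v uv))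
  where
  h : Fin (n M′) → Fin (pred (n M))
  h u = punchOut′ (w∉f u ∘ sym)
  f≡ : ∀ u → punchIn′ w (h u) ≡ f u
  f≡ u = punchIn′-punchOut′ (w∉f u ∘ sym)

isEndpoint : ∀ {m} → Fin m → Fin m → Fin m → Bool
isEndpoint x y a = does (a Fin.≟ x) ∨ does (a Fin.≟ y)

isEndpoint⇒ : ∀ {m} {x y a : Fin m} → isEndpoint x y a ≡ true → a ≡ x ⊎ a ≡ y
isEndpoint⇒ {x = x} {y} {a} _ with a Fin.≟ x | a Fin.≟ y
... | yes a≡x | _ = inj₁ a≡x
... | no _ | yes a≡y = inj₂ a≡y

-- Deletes every edge with both ends in {x, y}, which is just the edge xy.
removeEdge : (M : Graph) → Fin (n M) → Fin (n M) → Graph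
removeEdge M x y = record
  { n = n M
  ; adj = λ a b → adj M a b ∧ not (isEndpoint x y a ∧ isEndpoint x y b)
  ; sym = λ a b → cong₂ _∧_ (Graph.sym M a b) (cong not (Bool.∧-comm (isEndpoint x y a) _))
  ; irrefl = λ a → cong (_∧ _) (irrefl M a) }

removeEdge-⊆ : ∀ M x y → removeEdge M x y ⊆G M
removeEdge-⊆ M x y = id , (λ _ _ eq → eq) , λ a b → Bool.∧-conicalˡ _ _

removeEdge-removes : ∀ M x y → adj (removeEdge M x y) x y ≡ false
removeEdge-removes M x y
  rewrite dec-true (x Fin.≟ x) refl | dec-true (y Fin.≟ y) refl | Bool.∨-zeroʳ (does (y Fin.≟ x)) =
  Bool.∧-zeroʳ (adj M x y)

⊆-removeEdge : ∀ {M′ M} ((f , _) : M′ ⊆G M) {x y} →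
  (∀ u v → adj M′ u v ≡ true → f u ≡ x → f v ≡ y → ⊥) → M′ ⊆G removeEdge M x y
⊆-removeEdge {M′} {M} (f , f-inj , f-hom) {x} {y} xy∉f = f , f-inj , hom
  where
  notBoth : ∀ u v → adj M′ u v ≡ true → isEndpoint x y (f u) ∧ isEndpoint x y (f v) ≡ false
  notBoth u v uv with isEndpoint x y (f u) in eu | isEndpoint x y (f v) in ev
  ... | false | _ = refl
  ... | true | false = refl
  ... | true | true with isEndpoint⇒ eu | isEndpoint⇒ ev
  ...   | inj₁ fu≡x | inj₁ fv≡x = ⊥-elim (adj⇒≢ M′ uv (f-inj u v (trans fu≡x (sym fv≡x))))
  ...   | inj₂ fu≡y | inj₂ fv≡y = ⊥-elim (adj⇒≢ M′ uv (f-inj u v (trans fu≡y (sym fv≡y))))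
  ...   | inj₁ fu≡x | inj₂ fv≡y = ⊥-elim (xy∉f u v uv fu≡x fv≡y)
  ...   | inj₂ fu≡y | inj₁ fv≡x = ⊥-elim (xy∉f v u (trans (Graph.sym M′ v u) uv) fv≡x fu≡y)
  hom : ∀ u v → adj M′ u v ≡ true → adj (removeEdge M x y) (f u) (f v) ≡ true
  hom u v uv rewrite f-hom u v uv | notBoth u v uv = refl

edgeSet : ∀ {m} → (Fin m → Fin m → Bool) → Subset (m * m)
edgeSet {m} a = tabulate (uncurry a ∘ Fin.remQuot m)

∈-tabulate⁺ : ∀ {m} {f : Fin m → Bool} {i} → f i ≡ true → i ∈ tabulate f
∈-tabulate⁺ {f = f} {i} fi = Vec.lookup⇒[]= i _ (trans (Vec.lookup∘tabulate f i) fi)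

∈-tabulate⁻ : ∀ {m} {f : Fin m → Bool} {i} → i ∈ tabulate f → f i ≡ true
∈-tabulate⁻ {f = f} {i} i∈ = trans (sym (Vec.lookup∘tabulate f i)) (Vec.[]=⇒lookup i∈)

edgeSet-⊂ : ∀ {m} {a a′ : Fin m → Fin m → Bool} {x y} → (∀ u v → a′ u v ≡ true → a u v ≡ true) →
  a x y ≡ true → a′ x y ≡ false → edgeSet a′ ⊂ edgeSet a
edgeSet-⊂ {m} {a} {a′} {x} {y} a′⊆a xy∈a xy∉a′ =
  (λ i∈ → ∈-tabulate⁺ (a′⊆a _ _ (∈-tabulate⁻ i∈))) ,
  Fin.combine x y ,
  ∈-tabulate⁺ (trans (at-xy a) xy∈a) ,
  λ xy∈ → Bool.not-¬ xy∉a′ (trans (sym (at-xy a′)) (∈-tabulate⁻ xy∈))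
  where
  at-xy : ∀ b → uncurry b (Fin.remQuot m (Fin.combine x y)) ≡ b x y
  at-xy b = cong (uncurry b) (Fin.remQuot-combine x y)

removeEdge-⊂ : ∀ M {x y} → adj M x y ≡ true → edgeSet (adj (removeEdge M x y)) ⊂ edgeSet (adj M)
removeEdge-⊂ M {x} {y} xy =
  edgeSet-⊂ {a = adj M} {a′ = adj (removeEdge M x y)} (λ a b → Bool.∧-conicalˡ _ _) xy
    (removeEdge-removes M x y)

⊆G-onto-cases : ∀ {M′ M} ((f , _) : M′ ⊆G M) → (∀ w → ∃ λ u → f u ≡ w) →
  (∃₂ λ x y → adj M x y ≡ true × M′ ⊆G removeEdge M x y) ⊎ M ⊆G M′
⊆G-onto-cases {M′} {M} sub@(f , f-inj , f-hom) onto =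
  decide (Fin.any? λ x → Fin.any? λ y →
    (adj M x y Bool.≟ true) ×-dec (adj M′ (g x) (g y) Bool.≟ false))
  where
  g : Fin (n M) → Fin (n M′)
  g w = proj₁ (onto w)
  f∘g : ∀ w → f (g w) ≡ w
  f∘g w = proj₂ (onto w)
  f⁻¹ : ∀ {u w} → f u ≡ w → u ≡ g w
  f⁻¹ {u} {w} fu≡w = f-inj u (g w) (trans fu≡w (sym (f∘g w)))
  decide : Dec (∃₂ λ x y → adj M x y ≡ true × adj M′ (g x) (g y) ≡ false) →
    (∃₂ λ x y → adj M x y ≡ true × M′ ⊆G removeEdge M x y) ⊎ M ⊆G M′
  decide (yes (x , y , xy , gxy)) = inj₁ (x , y , xy , ⊆-removeEdge {M′} {M} sub
    λ u v uv fu≡x fv≡y → Bool.not-¬ gxy (subst₂ (λ a b → adj M′ a b ≡ true) (f⁻¹ fu≡x) (f⁻¹ fv≡y) uv))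
  decide (no none) = inj₂ (g , (λ x y eq → trans (sym (f∘g x)) (trans (cong f eq) (f∘g y))) ,
    λ x y xy → Bool.¬-not λ gxy → none (x , y , xy , gxy))

⊆G-cases : ∀ {M′ M} → M′ ⊆G M →
  (∃ λ w → M′ ⊆G removeVertex M w) ⊎
  (∃₂ λ x y → adj M x y ≡ true × M′ ⊆G removeEdge M x y) ⊎
  M ⊆G M′
⊆G-cases {M′} {M} sub@(f , _) = decide (Fin.any? λ w → ¬? (Fin.any? λ u → f u Fin.≟ w))
  where
  decide : Dec (∃ λ w → ¬ ∃ λ u → f u ≡ w) →
    (∃ λ w → M′ ⊆G removeVertex M w) ⊎
    (∃₂ λ x y → adj M x y ≡ true × M′ ⊆G removeEdge M x y) ⊎ M ⊆G M′
  decide (yes (w , w∉f)) = inj₁ (w , ⊆-removeVertex {M′} {M} sub λ u fu≡w → w∉f (u , fu≡w))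
  decide (no onto) = inj₂ (⊆G-onto-cases {M′} {M} sub λ w →
    decidable-stable (Fin.any? λ u → f u Fin.≟ w) λ w∉f → onto (w , w∉f))

Minimal : (Graph → Set) → Graph → Set
Minimal P M = P M × (∀ M′ → M′ ⊆G M → P M′ → M ⊆G M′)

module _ {P : Graph → Set} (P-mono : ∀ {M′ M} → M′ ⊆G M → P M′ → P M) where

  minimal-if-undeletable : ∀ {M} → (∀ w → ¬ P (removeVertex M w)) →
    (∀ x y → adj M x y ≡ true → ¬ P (removeEdge M x y)) → P M → Minimal P M
  minimal-if-undeletable {M} ¬pv ¬pe pM = pM , minimality
    where
    minimality : ∀ M′ → M′ ⊆G M → P M′ → M ⊆G M′
    minimality M′ M′⊆M pM′ with ⊆G-cases {M′} {M} M′⊆M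
    ... | inj₁ (w , s) = ⊥-elim (¬pv w (P-mono s pM′))
    ... | inj₂ (inj₁ (x , y , xy , s)) = ⊥-elim (¬pe x y xy (P-mono s pM′))
    ... | inj₂ (inj₂ M⊆M′) = M⊆M′

  minimal-subgraph : (∀ M → Dec (P M)) → ∀ {M} → P M → ∃ λ M₀ → M₀ ⊆G M × Minimal P M₀
  minimal-subgraph P? pM = descend _ (<-wellFounded _) (⊂-wellFounded _) pM
    where
    within : ∀ {M₁ M} → M₁ ⊆G M → (∃ λ M₀ → M₀ ⊆G M₁ × Minimal P M₀) →
      ∃ λ M₀ → M₀ ⊆G M × Minimal P M₀
    within {M₁} {M} M₁⊆M (M₀ , M₀⊆M₁ , min) = M₀ , ⊆G-trans {M₀} {M₁} {M} M₀⊆M₁ M₁⊆M , min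
    -- The accessibility proofs are matched only inside the with-branches, so that the
    -- termination checker sees the lexicographic decrease (vertices, then edges).
    descend : ∀ M → Acc _<_ (n M) → Acc _⊂_ (edgeSet (adj M)) → P M →
      ∃ λ M₀ → M₀ ⊆G M × Minimal P M₀
    descend M accV accE pM with Fin.any? (P? ∘ removeVertex M)
    descend M (acc fewer-vertices) accE pM | yes (w , pw) =
      within {removeVertex M w} {M} (removeVertex-⊆ M w)
        (descend (removeVertex M w) (fewer-vertices (pred< w)) (⊂-wellFounded _) pw)
    ... | no ¬pv
      with Fin.any? (λ x → Fin.any? λ y → (adj M x y Bool.≟ true) ×-dec P? (removeEdge M x y))
    descend M accV (acc fewer-edges) pM | no ¬pv | yes (x , y , xy , pe) =
      within {removeEdge M x y} {M} (removeEdge-⊆ M x y)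
        (descend (removeEdge M x y) accV (fewer-edges (removeEdge-⊂ M xy)) pe)
    ...   | no ¬pe = M , ⊆G-refl {M} , minimal-if-undeletable {M}
      (λ w pw → ¬pv (w , pw)) (λ x y xy pe → ¬pe (x , y , xy , pe)) pM

module _ (H : Graph) (p : ℕ) where

  hostSize : Graph → ℕ
  hostSize M = n M + n H

  module _ {M′ M : Graph} {t : ℕ} (g : Fin (n M′) → Fin (n M)) where

    -- The isolated and multipartite vertices are renamed after the vertex of H placed on
    -- them: injectivity is kept, and t = hostSize M is always enough.
    relabel : Fin (n H) → HostV M′ p t → HostV M p (hostSize M)
    relabel u (inj₁ (inj₁ a)) = inj₁ (inj₁ (g a))
    relabel u (inj₁ (inj₂ _)) =
      inj₁ (inj₂ (Fin.inject≤ u (ℕ.≤-reflexive (sym (ℕ.m+n∸m≡n (n M) (n H))))))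
    relabel u (inj₂ (i , _)) = inj₂ (i , Fin.inject≤ u (ℕ.m≤n+m (n H) (n M)))

    relabel-injective : (∀ a b → g a ≡ g b → a ≡ b) →
      ∀ u v x y → relabel u x ≡ relabel v y → x ≡ y ⊎ u ≡ v
    relabel-injective g-inj u v (inj₁ (inj₁ a)) (inj₁ (inj₁ b)) eq =
      inj₁ (cong (inj₁ ∘ inj₁) (g-inj a b (Sum.inj₁-injective (Sum.inj₁-injective eq))))
    relabel-injective g-inj u v (inj₁ (inj₂ _)) (inj₁ (inj₂ _)) eq =
      inj₂ (Fin.inject≤-injective _ _ u v (Sum.inj₂-injective (Sum.inj₁-injective eq)))
    relabel-injective g-inj u v (inj₂ _) (inj₁ (inj₁ _)) ()
    relabel-injective g-inj u v (inj₂ _) (inj₁ (inj₂ _)) ()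
    relabel-injective g-inj u v (inj₂ _) (inj₂ _) eq =
      inj₂ (Fin.inject≤-injective _ _ u v (,-injectiveʳ (Sum.inj₂-injective eq)))

    relabel-hom : (∀ a b → adj M′ a b ≡ true → adj M (g a) (g b) ≡ true) →
      ∀ u v x y → HostE M′ p t x y → HostE M p (hostSize M) (relabel u x) (relabel v y)
    relabel-hom g-hom u v (inj₁ (inj₁ a)) (inj₁ (inj₁ b)) ab = g-hom a b ab
    relabel-hom g-hom u v (inj₁ (inj₁ _)) (inj₂ _) _ = tt
    relabel-hom g-hom u v (inj₁ (inj₂ _)) (inj₂ _) _ = tt
    relabel-hom g-hom u v (inj₂ _) (inj₁ (inj₁ _)) _ = tt
    relabel-hom g-hom u v (inj₂ _) (inj₁ (inj₂ _)) _ = tt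
    relabel-hom g-hom u v (inj₂ _) (inj₂ _) i≢j = i≢j

  hostEmbedding-⊆ : ∀ {M′ M t} → M′ ⊆G M → Embeds H (HostV M′ p t) (HostE M′ p t) →
    Embeds H (HostV M p (hostSize M)) (HostE M p (hostSize M))
  hostEmbedding-⊆ {M′} {M} {t} (g , g-inj , g-hom) (f , f-inj , f-hom) =
    (λ u → relabel {M′} {M} {t} g u (f u)) ,
    (λ u v eq → [ f-inj u v , id ]′ (relabel-injective {M′} {M} {t} g g-inj u v (f u) (f v) eq)) ,
    (λ u v uv → relabel-hom {M′} {M} {t} g g-hom u v (f u) (f v) (f-hom u v uv))

  hostV↔Fin : ∀ {M t} → HostV M p t ↔ Fin ((n M + (t ∸ n M)) + (p ∸ 2) * t)
  hostV↔Fin = ↔-sym (↔-trans Fin.+↔⊎ (Fin.+↔⊎ ⊎-↔ Fin.*↔×))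

  hostE? : ∀ M t x y → Dec (HostE M p t x y)
  hostE? M t (inj₁ (inj₁ a)) (inj₁ (inj₁ b)) = adj M a b Bool.≟ true
  hostE? M t (inj₁ (inj₁ _)) (inj₁ (inj₂ _)) = no λ ()
  hostE? M t (inj₁ (inj₂ _)) (inj₁ _) = no λ ()
  hostE? M t (inj₁ (inj₁ _)) (inj₂ _) = yes tt
  hostE? M t (inj₁ (inj₂ _)) (inj₂ _) = yes tt
  hostE? M t (inj₂ _) (inj₁ (inj₁ _)) = yes tt
  hostE? M t (inj₂ _) (inj₁ (inj₂ _)) = yes tt
  hostE? M t (inj₂ (i , _)) (inj₂ (j , _)) = ¬? (i Fin.≟ j)

  DecompProp-mono : ∀ {M′ M} → M′ ⊆G M → DecompProp H p M′ → DecompProp H p M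
  DecompProp-mono {M′} {M} M′⊆M (t , e) = hostSize M , hostEmbedding-⊆ {M′} {M} {t} M′⊆M e

  decompProp? : ∀ M → Dec (DecompProp H p M)
  decompProp? M = map′ (hostSize M ,_) (λ (t , e) → hostEmbedding-⊆ {M} {M} {t} (⊆G-refl {M}) e)
    (embeds? H (hostV↔Fin {M}) (hostE? M (hostSize M)))

  DecompProp-self : DecompProp H p H
  DecompProp-self =
    0 , inj₁ ∘ inj₁ , (λ u v → Sum.inj₁-injective ∘ Sum.inj₁-injective) , (λ _ _ uv → uv)

  𝓜-below : ∀ {M} → DecompProp H p M → ∃ λ M₀ → M₀ ⊆G M × 𝓜 H p M₀
  𝓜-below = minimal-subgraph DecompProp-mono decompProp?

  hostColoring : ∀ {M t} → ¬ Fin (n M) → HostV M p t → Fin (suc (p ∸ 2))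
  hostColoring M-empty (inj₁ (inj₁ a)) = ⊥-elim (M-empty a)
  hostColoring M-empty (inj₁ (inj₂ _)) = zero
  hostColoring M-empty (inj₂ (i , _)) = suc i

  hostColoring-proper : ∀ {M t} (M-empty : ¬ Fin (n M)) x y → HostE M p t x y →
    hostColoring {M} {t} M-empty x ≢ hostColoring {M} {t} M-empty y
  hostColoring-proper M-empty (inj₁ (inj₁ a)) _ _ = ⊥-elim (M-empty a)
  hostColoring-proper M-empty (inj₁ (inj₂ _)) (inj₁ (inj₁ b)) _ = ⊥-elim (M-empty b)
  hostColoring-proper M-empty (inj₂ _) (inj₁ (inj₁ b)) _ = ⊥-elim (M-empty b)
  hostColoring-proper M-empty (inj₁ (inj₂ _)) (inj₂ _) _ ()
  hostColoring-proper M-empty (inj₂ _) (inj₁ (inj₂ _)) _ ()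
  hostColoring-proper M-empty (inj₂ _) (inj₂ _) i≢j = i≢j ∘ Fin.suc-injective

  DecompProp-empty⇒colorable : ∀ {M} → ¬ Fin (n M) → DecompProp H p M → Colorable H (suc (p ∸ 2))
  DecompProp-empty⇒colorable {M} M-empty (t , f , _ , f-hom) =
    hostColoring {M} {t} M-empty ∘ f ,
    λ u v uv → hostColoring-proper {M} {t} M-empty (f u) (f v) (f-hom u v uv)

restrict : ∀ {m m′} → (Fin m → Fin m′) → Coloring m′ → Coloring m
restrict ι (c , c-sym) = (λ x y → c (ι x) (ι y)) , (λ x y → c-sym (ι x) (ι y))

MonoCopy-unrestrict : ∀ {m m′} {ι : Fin m → Fin m′} → (∀ x y → ι x ≡ ι y → x ≡ y) →
  ∀ col {b} A → MonoCopy m (restrict ι col) b A → MonoCopy m′ col b A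
MonoCopy-unrestrict {ι = ι} ι-inj (c , _) {b} A =
  Embeds-map {H = A} {E′ = λ x y → c x y ≡ b} ι ι-inj (λ _ _ e → e)

Arrows-≤ : ∀ {m m′ A 𝓑} → m ≤ m′ → Arrows m A 𝓑 → Arrows m′ A 𝓑
Arrows-≤ {A = A} m≤m′ arrows col with arrows (restrict (λ x → Fin.inject≤ x m≤m′) col)
... | inj₁ red = inj₁ (MonoCopy-unrestrict (Fin.inject≤-injective m≤m′ m≤m′) col A red)
... | inj₂ (B , B∈𝓑 , blue) =
  inj₂ (B , B∈𝓑 , MonoCopy-unrestrict (Fin.inject≤-injective m≤m′ m≤m′) col B blue)

IsRamsey-least : ∀ {A 𝓑 r m} → IsRamsey A 𝓑 r → Arrows m A 𝓑 → r ≤ m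
IsRamsey-least (_ , below-r) arrows = ℕ.≮⇒≥ λ m<r → below-r _ m<r arrows

IsRamsey-positive : ∀ {A 𝓑 r} → ¬ Arrows 0 A 𝓑 → IsRamsey A 𝓑 r → 0 < r
IsRamsey-positive {r = zero} ¬arrows (arrows , _) = ⊥-elim (¬arrows arrows)
IsRamsey-positive {r = suc r} _ _ = ℕ.z<s

m≤m∸n+n : ∀ m n → m ≤ m ∸ n + n
m≤m∸n+n m n = ℕ.≤-trans (ℕ.m≤n+m∸n m n) (ℕ.≤-reflexive (ℕ.+-comm n (m ∸ n)))

-- Without 0 < m this fails when ∸ truncates (o > n).
0<m≤n∸o⇒m+o≤n : ∀ {m n o} → 0 < m → m ≤ n ∸ o → m + o ≤ n
0<m≤n∸o⇒m+o≤n {m} 0<m m≤n∸o =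
  ℕ.m≤o∸n⇒m+n≤o m (ℕ.<⇒≤ (ℕ.m∸n≢0⇒n<m (ℕ.n>0⇒n≢0 (ℕ.<-≤-trans 0<m m≤n∸o)))) m≤n∸o

blueGraph : (N : ℕ) → Coloring N → Graph
blueGraph N (c , c-sym) = record
  { n = N
  ; adj = λ x y → not (does (x Fin.≟ y)) ∧ not (c x y)
  ; sym = λ x y → cong₂ (λ d e → not d ∧ not e)
      (does-⇔ (mk⇔ sym sym) (x Fin.≟ y) (y Fin.≟ x)) (c-sym x y)
  ; irrefl = λ x → cong (λ d → not d ∧ _) (dec-true (x Fin.≟ x) refl) }

blue-adj⁻ : ∀ {N} col {x y} → adj (blueGraph N col) x y ≡ true → proj₁ col x y ≡ false
blue-adj⁻ col xy = Bool.not-injective (Bool.∧-conicalʳ _ _ xy)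

blue-adj⁺ : ∀ {N} col {x y} → x ≢ y → proj₁ col x y ≡ false → adj (blueGraph N col) x y ≡ true
blue-adj⁺ col {x} {y} x≢y xy rewrite dec-false (x Fin.≟ y) x≢y | xy = refl

MonoCopy-blue⇒⊆ : ∀ {N} col X → MonoCopy N col false X → X ⊆G blueGraph N col
MonoCopy-blue⇒⊆ {N} col X blue =
  Embeds-map {E = λ x y → x ≢ y × proj₁ col x y ≡ false} {H = X}
    {E′ = λ x y → adj (blueGraph N col) x y ≡ true}
    id (λ _ _ eq → eq) (λ _ _ (x≢y , xy) → blue-adj⁺ col x≢y xy)
    (Embeds-distinct {E = λ x y → proj₁ col x y ≡ false} {H = X} blue)

⊆-blue⇒MonoCopy : ∀ {N} col X → X ⊆G blueGraph N col → MonoCopy N col false X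
⊆-blue⇒MonoCopy col X =
  Embeds-map {H = X} {E′ = λ x y → proj₁ col x y ≡ false} id (λ _ _ eq → eq) (λ _ _ → blue-adj⁻ col)

module _ {H : Graph} {p : ℕ} where

  DecompProp-blue⇒blue𝓜 : ∀ {N} col → DecompProp H p (blueGraph N col) →
    ∃ λ M → 𝓜 H p M × MonoCopy N col false M
  DecompProp-blue⇒blue𝓜 col d with 𝓜-below H p d
  ... | M , M⊆blue , M∈𝓜 = M , M∈𝓜 , ⊆-blue⇒MonoCopy col M M⊆blue

  blueH⇒blue𝓜 : ∀ {N} col → MonoCopy N col false H → ∃ λ M → 𝓜 H p M × MonoCopy N col false M
  blueH⇒blue𝓜 col blue =
    DecompProp-blue⇒blue𝓜 col
      (DecompProp-mono H p (MonoCopy-blue⇒⊆ col H blue) (DecompProp-self H p))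

  ¬Arrows-0 : 1 ≤ n H → HasChromaticNumber H p → 2 ≤ p → ¬ Arrows 0 H (𝓜 H p)
  ¬Arrows-0 H-nonempty (_ , χ-least) 2≤p arrows with arrows ((λ ()) , (λ ()))
  ... | inj₁ (f , _) = Fin.¬Fin0 (f (Fin.fromℕ< H-nonempty))
  ... | inj₂ (M , (d , _) , (g , _)) =
    too-few-colors 2≤p (χ-least _ (DecompProp-empty⇒colorable H p {M} (Fin.¬Fin0 ∘ g) d))
    where
    too-few-colors : ∀ {q} → 2 ≤ q → ¬ q ≤ suc (q ∸ 2)
    too-few-colors {suc zero} (ℕ.s≤s ())
    too-few-colors {suc (suc q)} _ = ℕ.n≮n (suc q)

avoidPoint : ∀ {k m} (ι : Fin (suc k) → Fin m) → (∀ x y → ι x ≡ ι y → x ≡ y) → ∀ z →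
  ∃ λ (σ : Fin k → Fin (suc k)) → (∀ x y → σ x ≡ σ y → x ≡ y) × (∀ x → ι (σ x) ≢ z)
avoidPoint ι ι-inj z with Fin.any? (λ w → ι w Fin.≟ z)
... | yes (w , ιw≡z) = punchIn w , Fin.punchIn-injective w , λ x eq →
  Fin.punchInᵢ≢i w x (ι-inj _ _ (trans eq (sym ιw≡z)))
... | no z∉ι = Fin.inject₁ , (λ _ _ → Fin.inject₁-injective) , λ x eq → z∉ι (_ , eq)

avoiding : ∀ a {k m} (f : Fin a → Fin m) → k + a ≤ m →
  ∃ λ (ι : Fin k → Fin m) → (∀ x y → ι x ≡ ι y → x ≡ y) × (∀ x u → ι x ≢ f u)
avoiding zero {k} f k≤m =
  (λ x → Fin.inject≤ x (ℕ.m+n≤o⇒m≤o k k≤m)) , Fin.inject≤-injective _ _ , λ _ ()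
avoiding (suc a) {k} {m} f k+a<m
  with avoiding a {suc k} (f ∘ suc) (subst (_≤ m) (ℕ.+-suc k a) k+a<m)
... | ι , ι-inj , ι∉f with avoidPoint ι ι-inj (f zero)
...   | σ , σ-inj , σ∉ =
  ι ∘ σ , (λ x y → σ-inj x y ∘ ι-inj _ _) , λ { x zero → σ∉ x ; x (suc u) → ι∉f (σ x) u }

Arrows-∪ : ∀ {G H 𝓑 b c} →
  (∀ {N} col → MonoCopy N col false H → ∃ λ B → 𝓑 B × MonoCopy N col false B) →
  Arrows b G (Single H) → Arrows c H 𝓑 → Arrows (b ⊔ (c + n G)) (G ∪G H) 𝓑
Arrows-∪ {G} {H} {𝓑} {b} {c} blueH⇒blue𝓑 arrowsG arrowsH col
  with Arrows-≤ {A = G} {Single H} (ℕ.m≤m⊔n b (c + n G)) arrowsG col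
... | inj₂ (_ , refl , blueH) = inj₂ (blueH⇒blue𝓑 col blueH)
... | inj₁ redG with avoiding (n G) (proj₁ redG) (ℕ.m≤n⊔m b (c + n G))
...   | ι , ι-inj , ι∉G with arrowsH (restrict ι col)
...     | inj₂ (B , B∈𝓑 , blueB) = inj₂ (B , B∈𝓑 , MonoCopy-unrestrict ι-inj col B blueB)
...     | inj₁ redH = inj₁ (Embeds-∪ {E = λ x y → proj₁ col x y ≡ true} {G} {H}
  redG (MonoCopy-unrestrict ι-inj col H redH) λ u v eq → ι∉G _ u (sym eq))

module BlowUp (P s : ℕ) where

  Blown : ℕ → Set
  Blown N = Fin N ⊎ (Fin P × Fin s)

  blown↔ : ∀ {N} → Fin (N + P * s) ↔ Blown N
  blown↔ = ↔-trans Fin.+↔⊎ (↔-refl ⊎-↔ Fin.*↔×)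

  blownColor : ∀ {N} → (Fin N → Fin N → Bool) → Blown N → Blown N → Bool
  blownColor c (inj₁ a) (inj₁ b) = c a b
  blownColor c (inj₂ (i , _)) (inj₂ (j , _)) = does (i Fin.≟ j)
  blownColor c (inj₁ _) (inj₂ _) = false
  blownColor c (inj₂ _) (inj₁ _) = false

  blownColor-sym : ∀ {N} {c : Fin N → Fin N → Bool} → (∀ a b → c a b ≡ c b a) →
    ∀ d e → blownColor c d e ≡ blownColor c e d
  blownColor-sym c-sym (inj₁ a) (inj₁ b) = c-sym a b
  blownColor-sym c-sym (inj₂ (i , _)) (inj₂ (j , _)) = does-⇔ (mk⇔ sym sym) (i Fin.≟ j) (j Fin.≟ i)
  blownColor-sym c-sym (inj₁ _) (inj₂ _) = refl
  blownColor-sym c-sym (inj₂ _) (inj₁ _) = refl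

  blowUp : ∀ {N} → Coloring N → Coloring (N + P * s)
  blowUp (c , c-sym) =
    (λ x y → blownColor c (to x) (to y)) , (λ x y → blownColor-sym c-sym (to x) (to y))
    where open Inverse blown↔

  MonoCopy-blowUp : ∀ {N} col {b} A → MonoCopy (N + P * s) (blowUp col) b A →
    Embeds A (Blown N) (λ d e → blownColor (proj₁ col) d e ≡ b)
  MonoCopy-blowUp (c , _) {b} A =
    Embeds-map {H = A} {E′ = λ d e → blownColor c d e ≡ b} to (↔-to-injective blown↔) (λ _ _ e → e)
    where open Inverse blown↔

  block : ∀ {N} → Blown N → Maybe (Fin P)
  block (inj₁ _) = nothing
  block (inj₂ (i , _)) = just i

  red⇒sameBlock : ∀ {N} {c : Fin N → Fin N → Bool} d e → blownColor c d e ≡ true → block d ≡ block e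
  red⇒sameBlock (inj₁ _) (inj₁ _) _ = refl
  red⇒sameBlock (inj₂ (i , _)) (inj₂ (j , _)) _ with i Fin.≟ j
  ... | yes i≡j = cong just i≡j

module _ {H : Graph} {p s : ℕ} where
  open BlowUp (p ∸ 2) s

  red-blowUp : Connected H → s < n H → ∀ {N} {c : Fin N → Fin N → Bool} →
    Embeds H (Blown N) (λ d e → blownColor c d e ≡ true) → Embeds H (Fin N) (λ a b → c a b ≡ true)
  red-blowUp H-conn s<n {N} {c} red@(f , _ , f-hom) =
    fromBlock (block (f u₀)) λ u → Connected-constant H-conn (block ∘ f)
      (λ u v uv → red⇒sameBlock (f u) (f v) (f-hom u v uv)) u u₀
    where
    u₀ : Fin (n H)
    u₀ = Fin.fromℕ< (proj₁ H-conn)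
    original : ∀ d → block d ≡ nothing → ∃ λ a → inj₁ a ≡ d
    original (inj₁ a) _ = a , refl
    inBlock : ∀ {i} d → block d ≡ just i → ∃ λ j → inj₂ (i , j) ≡ d
    inBlock (inj₂ (i , j)) refl = j , refl
    fromBlock : ∀ κ → (∀ u → block (f u) ≡ κ) → Embeds H (Fin N) (λ a b → c a b ≡ true)
    fromBlock nothing all =
      Embeds-factor {E = λ d e → blownColor c d e ≡ true} {H = H}
        inj₁ red (λ u → original (f u) (all u))
    fromBlock (just i) all
      with Embeds-factor {E = λ d e → blownColor c d e ≡ true} {H = H}
             (λ j → inj₂ (i , j)) red (λ u → inBlock (f u) (all u))
    ... | g , g-inj , _ = ⊥-elim (ℕ.<⇒≱ s<n (Fin.injective⇒≤ λ {u} {v} → g-inj u v))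

  blue-blowUp : ∀ {N} col → Embeds H (Blown N) (λ d e → blownColor (proj₁ col) d e ≡ false) →
    DecompProp H p (blueGraph N col)
  blue-blowUp {N} col@(c , _) blue =
    s , Embeds-map {H = H} {E′ = HostE (blueGraph N col) p s} ψ ψ-inj ψ-hom
          (Embeds-distinct {E = λ d e → blownColor c d e ≡ false} {H = H} blue)
    where
    ψ : Blown N → HostV (blueGraph N col) p s
    ψ (inj₁ a) = inj₁ (inj₁ a)
    ψ (inj₂ ij) = inj₂ ij
    ψ-inj : ∀ d e → ψ d ≡ ψ e → d ≡ e
    ψ-inj (inj₁ a) (inj₁ b) eq = cong inj₁ (Sum.inj₁-injective (Sum.inj₁-injective eq))
    ψ-inj (inj₂ _) (inj₂ _) eq = cong inj₂ (Sum.inj₂-injective eq)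
    ψ-hom : ∀ d e → d ≢ e × blownColor c d e ≡ false → HostE (blueGraph N col) p s (ψ d) (ψ e)
    ψ-hom (inj₁ a) (inj₁ b) (a≢b , ab) = blue-adj⁺ col (a≢b ∘ cong inj₁) ab
    ψ-hom (inj₂ (i , _)) (inj₂ (j , _)) (_ , i≢j) i≡j = Bool.not-¬ (dec-true (i Fin.≟ j) i≡j) i≢j
    ψ-hom (inj₁ _) (inj₂ _) _ = tt
    ψ-hom (inj₂ _) (inj₁ _) _ = tt

  Arrows-blowUp : Connected H → s < n H → ∀ {N} →
    Arrows (N + (p ∸ 2) * s) H (Single H) → Arrows N H (𝓜 H p)
  Arrows-blowUp H-conn s<n arrows col with arrows (blowUp col)
  ... | inj₁ red = inj₁ (red-blowUp H-conn s<n (MonoCopy-blowUp col H red))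
  ... | inj₂ (_ , refl , blue) =
    inj₂ (DecompProp-blue⇒blue𝓜 {H} {p} col (blue-blowUp col (MonoCopy-blowUp col H blue)))

lemma2p6 : (G H : Graph) (p : ℕ) → Connected G → Connected H →
    HasChromaticNumber H p → 3 ≤ p →
    ((r₂ rM : ℕ) → IsRamsey H (Single H) r₂ → IsRamsey H (𝓜 H p) rM →
      rM + (p ∸ 2) * (∣V∣ H ∸ 1) ≤ r₂)
    ×
    ((a b c : ℕ) → IsRamsey (G ∪G H) (𝓜 H p) a → IsRamsey G (Single H) b →
      IsRamsey H (𝓜 H p) c → a ≤ b ⊔ (c + ∣V∣ G))
lemma2p6 G H p _ H-conn χ 3≤p = part-i , part-ii
  where
  k : ℕ
  k = (p ∸ 2) * (n H ∸ 1)
  part-i : (r₂ rM : ℕ) → IsRamsey H (Single H) r₂ → IsRamsey H (𝓜 H p) rM → rM + k ≤ r₂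
  part-i r₂ rM (r₂-arrows , _) rM-ramsey =
    0<m≤n∸o⇒m+o≤n
      (IsRamsey-positive {H} {𝓜 H p} (¬Arrows-0 {H} {p} (proj₁ H-conn) χ 2≤p) rM-ramsey)
      (IsRamsey-least {H} {𝓜 H p} rM-ramsey
        (Arrows-blowUp {H} {p} H-conn (ℕ.∸-monoʳ-< ℕ.z<s (proj₁ H-conn))
          (Arrows-≤ {A = H} {Single H} (m≤m∸n+n r₂ k) r₂-arrows)))
    where
    2≤p : 2 ≤ p
    2≤p = ℕ.≤-trans (ℕ.n≤1+n 2) 3≤p
  part-ii : (a b c : ℕ) → IsRamsey (G ∪G H) (𝓜 H p) a → IsRamsey G (Single H) b →
    IsRamsey H (𝓜 H p) c → a ≤ b ⊔ (c + n G)
  part-ii a b c a-ramsey (b-arrows , _) (c-arrows , _) =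
    IsRamsey-least {G ∪G H} {𝓜 H p} a-ramsey
      (Arrows-∪ {G} {H} {𝓜 H p} (blueH⇒blue𝓜 {H} {p}) b-arrows c-arrows)
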